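{- In the standing setup of the context, any two distinct vertices of $L\cup\{u_1,u_2\}$ are adjacent in $G$.
   Context: Loop-free multigraph: finite undirected graph without loops, multiple edges between distinct vertices allowed. The type of an edge joining $u,v$ is $\{u,v\}$; its multiplicity is the number of edges of that type; an edge/type is simple if its multiplicity is one and non-simple if at least two; a graph is simple if all edges are simple. Two vertices are adjacent if there is at least one edge between them. Double edge swap $(a_1,a_2)(a_3,a_4)$: remove two distinct edges of types $\{a_1,a_2\},\{a_3,a_4\}$ and add edges of types $\{a_2,a_3\},\{a_4,a_1\}$; admissible if the removed edges share no endpoint and not both are simple. Orders: fix finite $V$ and $d:V\to\mathbb{N}$, and a total order $<$ on $V$ with $d(u)<d(v)\Rightarrow u<v$. For $u_1>u_2$, $v_1>v_2$ set $\{u_1,u_2\}\le\{v_1,v_2\}$ iff $u_1<v_1$ or ($u_1=v_1$ and $u_2\le v_2$). For loop-free multigraphs on $V$ with degrees $d$: $G'<G$ iff $G$ is not simple and either the maximal non-simple type of $G$ is larger than all non-simple types of $G'$, or the maximal non-simple types of $G'$ and $G$ coincide and its multiplicity is strictly larger in $G$ than in $G'$. Standing setup: $G$ is a non-simple loop-free multigraph on $V$ with $\deg_G v=d(v)$ for all $v$, such that no finite sequence of admissible double edge swaps transforms $G$ into a graph $G'$ with $G'<G$. Let $\{u_1,u_2\}$, $u_1>u_2$, be the maximal non-simple type of $G$. Vertices other than $u_1,u_2$ are ordinary. For $i=1,2$, $V_i$ is the set of ordinary vertices adjacent to $u_i$ and $\overline{V_i}$ the set of ordinary vertices not adjacent to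 $u_i$. An ordinary vertex is small if it is smaller than $u_1$ and large if it is larger than $u_1$. $L$ denotes the set of large vertices. -}

module Defs where

open import Data.Nat as ℕ using (ℕ; zero; suc; _+_)
open import Data.Fin as Fin using (Fin; _≟_)
open import Data.Bool using (Bool; true; false; _∧_; _∨_; if_then_else_)
open import Data.List using (map; allFin)
open import Data.Nat.ListAction using (sum)
open import Data.Product using (Σ; _×_; ∃; ∃-syntax; _,_)
open import Data.Sum using (_⊎_)
open import Relation.Nullary using (¬_)
open import Relation.Nullary.Decidable using (⌊_⌋)
open import Relation.Binary.PropositionalEquality using (_≡_; _≢_)
open import Relation.Binary.Construct.Closure.ReflexiveTransitive using (Star)

-- A loop-free multigraph on the vertex set Fin n, given by its edge
-- multiplicity function: mult v w = number of edges of type {v,w}.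
record Multigraph (n : ℕ) : Set where
  field
    mult     : Fin n → Fin n → ℕ
    symm     : ∀ v w → mult v w ≡ mult w v
    loopfree : ∀ v → mult v v ≡ 0
open Multigraph public

deg : ∀ {n} → Multigraph n → Fin n → ℕ
deg {n} G v = sum (map (mult G v) (allFin n))

ind : ∀ {n} → Fin n → Fin n → Fin n → Fin n → ℕ
ind x y v w =
  if (⌊ v ≟ x ⌋ ∧ ⌊ w ≟ y ⌋) ∨ (⌊ v ≟ y ⌋ ∧ ⌊ w ≟ x ⌋) then 1 else 0

-- Admissible double edge swap (a1,a2)(a3,a4) transforming G into G':
-- the removed edges (types {a1,a2},{a3,a4}) exist, share no endpoint
-- (so a1,a2,a3,a4 are pairwise distinct), not both are simple, and
-- G' = G - {a1,a2} - {a3,a4} + {a2,a3} + {a4,a1}.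
AdmSwap : ∀ {n} → Multigraph n → Multigraph n → Set
AdmSwap G G' = ∃[ a₁ ] ∃[ a₂ ] ∃[ a₃ ] ∃[ a₄ ]
  ( a₁ ≢ a₂ × a₁ ≢ a₃ × a₁ ≢ a₄ × a₂ ≢ a₃ × a₂ ≢ a₄ × a₃ ≢ a₄
  × 1 ℕ.≤ mult G a₁ a₂ × 1 ℕ.≤ mult G a₃ a₄
  × (2 ℕ.≤ mult G a₁ a₂ ⊎ 2 ℕ.≤ mult G a₃ a₄)
  × (∀ v w → mult G' v w + ind a₁ a₂ v w + ind a₃ a₄ v w
             ≡ mult G v w + ind a₂ a₃ v w + ind a₄ a₁ v w) )

Reach : ∀ {n} → Multigraph n → Multigraph n → Set
Reach = Star AdmSwap

-- Order on types, types written as (x₁,x₂) with x₁ > x₂ (the total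
-- order on V = Fin n is the standard order of Fin n).
TypeLe : ∀ {n} → Fin n → Fin n → Fin n → Fin n → Set
TypeLe u₁ u₂ v₁ v₂ = u₁ Fin.< v₁ ⊎ (u₁ ≡ v₁ × u₂ Fin.≤ v₂)

TypeLt : ∀ {n} → Fin n → Fin n → Fin n → Fin n → Set
TypeLt u₁ u₂ v₁ v₂ = u₁ Fin.< v₁ ⊎ (u₁ ≡ v₁ × u₂ Fin.< v₂)

NonSimpleType : ∀ {n} → Multigraph n → Fin n → Fin n → Set
NonSimpleType G x₁ x₂ = x₂ Fin.< x₁ × 2 ℕ.≤ mult G x₁ x₂

MaxNonSimple : ∀ {n} → Multigraph n → Fin n → Fin n → Set
MaxNonSimple G x₁ x₂ =
  NonSimpleType G x₁ x₂ ×
  (∀ a₁ a₂ → NonSimpleType G a₁ a₂ → TypeLe a₁ a₂ x₁ x₂)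

IsSimple : ∀ {n} → Multigraph n → Set
IsSimple G = ∀ v w → mult G v w ℕ.≤ 1

-- G' < G  (G non-simple is witnessed by the existence of its maximal
-- non-simple type)
_≺_ : ∀ {n} → Multigraph n → Multigraph n → Set
G' ≺ G = ∃[ x₁ ] ∃[ x₂ ] (MaxNonSimple G x₁ x₂ ×
  ( (∀ a₁ a₂ → NonSimpleType G' a₁ a₂ → TypeLt a₁ a₂ x₁ x₂)
  ⊎ (MaxNonSimple G' x₁ x₂ × mult G' x₁ x₂ ℕ.< mult G x₁ x₂)))

Adjacent : ∀ {n} → Multigraph n → Fin n → Fin n → Set
Adjacent G v w = 1 ℕ.≤ mult G v w

-- v ∈ L ∪ {u₁,u₂}, where L = ordinary vertices larger than u₁
InLU : ∀ {n} → Fin n → Fin n → Fin n → Set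
InLU u₁ u₂ v = v ≡ u₁ ⊎ v ≡ u₂ ⊎ (v ≢ u₁ × v ≢ u₂ × u₁ Fin.< v)

-- Every edge at a large vertex is simple, because {u₁,u₂} is the maximal
-- non-simple type.  If two vertices of L ∪ {u₁,u₂} were non-adjacent, one or
-- two admissible swaps through the parallel edges u₁u₂ would lower the
-- multiplicity of {u₁,u₂} while adding edges only between non-adjacent
-- vertices, hence creating no new non-simple type: a smaller graph.  The only
-- way out is that the row of a large vertex x is dominated entrywise, and
-- somewhere strictly, by the row of u₁ or u₂; then deg x < deg uᵢ, which
-- contradicts uᵢ < x in an order compatible with the degrees.

module Submission where

open import Defs
open import Data.Nat using (ℕ)
open import Data.Fin using (Fin)
open import Relation.Nullary using (¬_)
open import Relation.Binary.PropositionalEquality using (_≡_; _≢_)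
import Data.Nat as ℕ
import Data.Fin as Fin

open import Data.Bool using (Bool; true; false; _∧_; _∨_; if_then_else_)
import Data.Bool.Properties as Boolₚ
open import Data.Empty using (⊥)
open import Data.Fin using (_≟_)
open import Data.Fin.Permutation using (transpose)
import Data.Fin.Permutation.Components as PC
import Data.Fin.Properties as Finₚ
open import Data.List using (tabulate)
import Data.List.Properties as List
import Data.Nat.ListAction as List
open import Data.Nat using (zero; suc; _+_; _∸_; z≤n; s≤s)
import Data.Nat.Properties as ℕₚ
open import Data.Nat.Tactic.RingSolver using (solve-∀)
open import Data.Product using (_×_; _,_; proj₁; proj₂)
open import Data.Sum using (_⊎_; inj₁; inj₂)
open import Data.Vec.Functional using (Vector; removeAt)
open import Function using (_∘_)
open import Relation.Binary.Construct.Closure.ReflexiveTransitive using (ε; _◅_)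
open import Relation.Binary.Definitions using (tri<; tri≈; tri>)
open import Relation.Binary.PropositionalEquality
  using (refl; sym; trans; cong; cong₂; subst; subst₂; module ≡-Reasoning)
open import Relation.Nullary using (yes; no; contradiction)
open import Relation.Nullary.Decidable using (⌊_⌋)

open import Algebra.Properties.CommutativeMonoid.Sum ℕₚ.+-0-commutativeMonoid
  using () renaming (sum to ∑; sum-remove to ∑-remove; sum-permute to ∑-permute)

∑-tabulate : ∀ {n} (f : Fin n → ℕ) → List.sum (tabulate f) ≡ ∑ f
∑-tabulate {zero}  f = refl
∑-tabulate {suc n} f = cong (f Fin.zero +_) (∑-tabulate (λ i → f (Fin.suc i)))

deg≡∑ : ∀ {n} (G : Multigraph n) v → deg G v ≡ ∑ (mult G v)
deg≡∑ G v = trans (cong List.sum (List.map-tabulate (λ i → i) (mult G v))) (∑-tabulate (mult G v))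

∑-mono-≤ : ∀ {n} {f g : Vector ℕ n} → (∀ i → f i ℕ.≤ g i) → ∑ f ℕ.≤ ∑ g
∑-mono-≤ {zero}  f≤g = z≤n
∑-mono-≤ {suc n} f≤g = ℕₚ.+-mono-≤ (f≤g Fin.zero) (∑-mono-≤ (λ i → f≤g (Fin.suc i)))

∑-mono-< : ∀ {n} {f g : Vector ℕ n} (j : Fin n) → (∀ i → f i ℕ.≤ g i) → f j ℕ.< g j → ∑ f ℕ.< ∑ g
∑-mono-< {suc n} {f} {g} j f≤g fj<gj = begin-strict
  ∑ f                       ≡⟨ ∑-remove {i = j} f ⟩
  f j + ∑ (removeAt f j)    <⟨ ℕₚ.+-mono-<-≤ fj<gj (∑-mono-≤ (λ i → f≤g (Fin.punchIn j i))) ⟩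
  g j + ∑ (removeAt g j)    ≡⟨ ∑-remove {i = j} g ⟨
  ∑ g                       ∎
  where open ℕₚ.≤-Reasoning

-- The row of q, read through the transposition (p q), dominates the row of p.
deg-< : ∀ {n} (G : Multigraph n) p q r → r ≢ p → r ≢ q
      → mult G p r ℕ.< mult G q r
      → (∀ z → z ≢ p → z ≢ q → z ≢ r → mult G p z ℕ.≤ mult G q z)
      → deg G p ℕ.< deg G q
deg-< {n} G p q r r≢p r≢q pr<qr p≤q = begin-strict
  deg G p                              ≡⟨ deg≡∑ G p ⟩
  ∑ (mult G p)                         <⟨ ∑-mono-< r row≤ row<at-r ⟩
  ∑ (λ z → mult G q (τ z))             ≡⟨ ∑-permute (mult G q) (transpose p q) ⟨
  ∑ (mult G q)                         ≡⟨ deg≡∑ G q ⟨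
  deg G q                              ∎
  where
  open ℕₚ.≤-Reasoning
  τ : Fin n → Fin n
  τ = PC.transpose p q
  τ-fixes : ∀ z → z ≢ p → z ≢ q → τ z ≡ z
  τ-fixes z z≢p z≢q with z ≟ p
  ... | yes z≡p = contradiction z≡p z≢p
  ... | no _ with z ≟ q
  ...   | yes z≡q = contradiction z≡q z≢q
  ...   | no _    = refl
  row<at-r : mult G p r ℕ.< mult G q (τ r)
  row<at-r = subst (λ s → mult G p r ℕ.< mult G q s) (sym (τ-fixes r r≢p r≢q)) pr<qr
  row≤ : ∀ z → mult G p z ℕ.≤ mult G q (τ z)
  row≤ z with z ≟ p
  ... | yes refl = ℕₚ.≤-reflexive (trans (loopfree G z) (sym (loopfree G q)))
  ... | no z≢p with z ≟ q
  ...   | yes refl = ℕₚ.≤-reflexive (symm G p z)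
  ...   | no z≢q with z ≟ r
  ...     | yes refl = ℕₚ.<⇒≤ pr<qr
  ...     | no z≢r = p≤q z z≢p z≢q z≢r

+-≤-cancel : ∀ {x y i j} → x + i ≡ y + j → j ℕ.≤ i → x ℕ.≤ y
+-≤-cancel {x} {y} {i} {j} x+i≡y+j j≤i =
  ℕₚ.+-cancelʳ-≤ i x y (ℕₚ.≤-trans (ℕₚ.≤-reflexive x+i≡y+j) (ℕₚ.+-monoʳ-≤ y j≤i))

+-<-cancel : ∀ {x y i j} → x + i ≡ y + j → j ℕ.< i → x ℕ.< y
+-<-cancel {x} {y} {i} {j} x+i≡y+j j<i =
  ℕₚ.+-cancelʳ-< i x y (ℕₚ.≤-<-trans (ℕₚ.≤-reflexive x+i≡y+j) (ℕₚ.+-monoʳ-< y j<i))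

transit-≤ : ∀ {x x₁ x₂ r s o p a} → x₂ + (r + s) ≡ x₁ + a → x₁ + p ≡ x + (r + o) → x₂ ℕ.≤ x + (o + a)
transit-≤ {x} {x₁} {x₂} {r} {s} {o} {p} {a} second first = ℕₚ.+-cancelʳ-≤ r x₂ (x + (o + a)) (begin
  x₂ + r           ≤⟨ ℕₚ.+-monoʳ-≤ x₂ (ℕₚ.m≤m+n r s) ⟩
  x₂ + (r + s)     ≡⟨ second ⟩
  x₁ + a           ≤⟨ ℕₚ.+-monoˡ-≤ a (ℕₚ.m≤m+n x₁ p) ⟩
  x₁ + p + a       ≡⟨ cong (_+ a) first ⟩
  x + (r + o) + a  ≡⟨ rearrange x r o a ⟩
  x + (o + a) + r  ∎)
  where
  open ℕₚ.≤-Reasoning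
  rearrange : ∀ x r o a → x + (r + o) + a ≡ x + (o + a) + r
  rearrange = solve-∀

module _ {n : ℕ} where

  ind-match : ∀ {x y v w : Fin n} → ind x y v w ≡ 1 → (v ≡ x × w ≡ y) ⊎ (v ≡ y × w ≡ x)
  ind-match {x} {y} {v} {w} eq with v ≟ x | w ≟ y | v ≟ y | w ≟ x
  ... | yes v≡x | yes w≡y | _       | _       = inj₁ (v≡x , w≡y)
  ... | _       | _       | yes v≡y | yes w≡x = inj₂ (v≡y , w≡x)
  ... | yes _   | no _    | yes _   | no _    = contradiction eq ℕₚ.0≢1+n
  ... | yes _   | no _    | no _    | _       = contradiction eq ℕₚ.0≢1+n
  ... | no _    | _       | yes _   | no _    = contradiction eq ℕₚ.0≢1+n
  ... | no _    | _       | no _    | _       = contradiction eq ℕₚ.0≢1+n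

  ind-0∨1 : ∀ (x y v w : Fin n) → ind x y v w ≡ 0 ⊎ ind x y v w ≡ 1
  ind-0∨1 x y v w with (⌊ v ≟ x ⌋ ∧ ⌊ w ≟ y ⌋) ∨ (⌊ v ≟ y ⌋ ∧ ⌊ w ≟ x ⌋)
  ... | true  = inj₂ refl
  ... | false = inj₁ refl

  ind-sym : ∀ (x y v w : Fin n) → ind x y v w ≡ ind x y w v
  ind-sym x y v w = cong (λ b → if b then 1 else 0) (begin
    (vx ∧ wy) ∨ (vy ∧ wx) ≡⟨ Boolₚ.∨-comm (vx ∧ wy) (vy ∧ wx) ⟩
    (vy ∧ wx) ∨ (vx ∧ wy) ≡⟨ cong₂ _∨_ (Boolₚ.∧-comm vy wx) (Boolₚ.∧-comm vx wy) ⟩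
    (wx ∧ vy) ∨ (wy ∧ vx) ∎)
    where
    open ≡-Reasoning
    vx wy vy wx : Bool
    vx = ⌊ v ≟ x ⌋
    wy = ⌊ w ≟ y ⌋
    vy = ⌊ v ≟ y ⌋
    wx = ⌊ w ≟ x ⌋

  ind-≡1 : ∀ (x y : Fin n) → ind x y x y ≡ 1
  ind-≡1 x y with x ≟ x | y ≟ y
  ... | yes _   | yes _   = refl
  ... | no x≢x  | _       = contradiction refl x≢x
  ... | yes _   | no y≢y  = contradiction refl y≢y

  ind-≡0ˡ : ∀ {x y v : Fin n} w → v ≢ x → v ≢ y → ind x y v w ≡ 0
  ind-≡0ˡ {x} {y} {v} w v≢x v≢y with ind-0∨1 x y v w
  ... | inj₁ ≡0 = ≡0
  ... | inj₂ ≡1 with ind-match {x} {y} {v} {w} ≡1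
  ...   | inj₁ (v≡x , _) = contradiction v≡x v≢x
  ...   | inj₂ (v≡y , _) = contradiction v≡y v≢y

  ind-≡0ʳ : ∀ {x y w : Fin n} v → w ≢ x → w ≢ y → ind x y v w ≡ 0
  ind-≡0ʳ {x} {y} {w} v w≢x w≢y = trans (ind-sym x y v w) (ind-≡0ˡ v w≢x w≢y)

  ind-apartˡ : ∀ {a b c d : Fin n} → a ≢ c → a ≢ d → ∀ v w → ind a b v w ≡ 1 → ind c d v w ≡ 0
  ind-apartˡ {a} {b} a≢c a≢d v w ≡1 with ind-match {a} {b} {v} {w} ≡1
  ... | inj₁ (refl , _) = ind-≡0ˡ w a≢c a≢d
  ... | inj₂ (_ , refl) = ind-≡0ʳ v a≢c a≢d

  ind-apartʳ : ∀ {a b c d : Fin n} → b ≢ c → b ≢ d → ∀ v w → ind a b v w ≡ 1 → ind c d v w ≡ 0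
  ind-apartʳ {a} {b} b≢c b≢d v w ≡1 with ind-match {a} {b} {v} {w} ≡1
  ... | inj₁ (_ , refl) = ind-≡0ʳ v b≢c b≢d
  ... | inj₂ (refl , _) = ind-≡0ˡ w b≢c b≢d

  ind-diag : ∀ {x y : Fin n} v → x ≢ y → ind x y v v ≡ 0
  ind-diag {x} {y} v x≢y with ind-0∨1 x y v v
  ... | inj₁ ≡0 = ≡0
  ... | inj₂ ≡1 with ind-match {x} {y} {v} {v} ≡1
  ...   | inj₁ (refl , refl) = contradiction refl x≢y
  ...   | inj₂ (refl , refl) = contradiction refl x≢y

  mult-of-ind : ∀ (G : Multigraph n) {a b v w : Fin n} → ind a b v w ≡ 1 → mult G v w ≡ mult G a b
  mult-of-ind G {a} {b} {v} {w} ≡1 with ind-match {a} {b} {v} {w} ≡1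
  ... | inj₁ (refl , refl) = refl
  ... | inj₂ (refl , refl) = symm G v w

module Swap {n} (G : Multigraph n) {a₁ a₂ a₃ a₄ : Fin n}
  (a₁≢a₂ : a₁ ≢ a₂) (a₁≢a₃ : a₁ ≢ a₃) (a₁≢a₄ : a₁ ≢ a₄)
  (a₂≢a₃ : a₂ ≢ a₃) (a₂≢a₄ : a₂ ≢ a₄) (a₃≢a₄ : a₃ ≢ a₄)
  (a₁a₂-parallel : 2 ℕ.≤ mult G a₁ a₂) (a₃a₄-edge : 1 ℕ.≤ mult G a₃ a₄) where

  removed added : Fin n → Fin n → ℕ
  removed v w = ind a₁ a₂ v w + ind a₃ a₄ v w
  added   v w = ind a₂ a₃ v w + ind a₄ a₁ v w

  removed≤mult : ∀ v w → removed v w ℕ.≤ mult G v w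
  removed≤mult v w with ind-0∨1 a₁ a₂ v w
  ... | inj₂ ≡1 = begin
    removed v w      ≡⟨ cong₂ _+_ ≡1 (ind-apartˡ a₁≢a₃ a₁≢a₄ v w ≡1) ⟩
    1                ≤⟨ ℕₚ.≤-trans (s≤s z≤n) a₁a₂-parallel ⟩
    mult G a₁ a₂     ≡⟨ mult-of-ind G ≡1 ⟨
    mult G v w       ∎
    where open ℕₚ.≤-Reasoning
  ... | inj₁ ≡0 with ind-0∨1 a₃ a₄ v w
  ...   | inj₁ ≡0′ = ℕₚ.≤-trans (ℕₚ.≤-reflexive (cong₂ _+_ ≡0 ≡0′)) z≤n
  ...   | inj₂ ≡1 = begin
    removed v w      ≡⟨ cong₂ _+_ ≡0 ≡1 ⟩
    1                ≤⟨ a₃a₄-edge ⟩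
    mult G a₃ a₄     ≡⟨ mult-of-ind G ≡1 ⟨
    mult G v w       ∎
    where open ℕₚ.≤-Reasoning

  swapped : Multigraph n
  mult swapped v w = (mult G v w + added v w) ∸ removed v w
  symm swapped v w = cong₂ _∸_
    (cong₂ _+_ (symm G v w) (cong₂ _+_ (ind-sym a₂ a₃ v w) (ind-sym a₄ a₁ v w)))
    (cong₂ _+_ (ind-sym a₁ a₂ v w) (ind-sym a₃ a₄ v w))
  loopfree swapped v = begin
    (mult G v v + added v v) ∸ removed v v  ≡⟨ cong (λ k → (k + added v v) ∸ removed v v) (loopfree G v) ⟩
    added v v ∸ removed v v                 ≡⟨ cong (_∸ removed v v) no-loop-added ⟩
    0 ∸ removed v v                         ≡⟨ ℕₚ.0∸n≡0 (removed v v) ⟩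
    0                                       ∎
    where
    open ≡-Reasoning
    no-loop-added : added v v ≡ 0
    no-loop-added = cong₂ _+_ (ind-diag v a₂≢a₃) (ind-diag v (a₁≢a₄ ∘ sym))

  swapped-balance : ∀ v w → mult swapped v w + removed v w ≡ mult G v w + added v w
  swapped-balance v w = ℕₚ.m∸n+n≡m (ℕₚ.≤-trans (removed≤mult v w) (ℕₚ.m≤m+n _ _))

  swapped-admissible : AdmSwap G swapped
  swapped-admissible = a₁ , a₂ , a₃ , a₄ , a₁≢a₂ , a₁≢a₃ , a₁≢a₄ , a₂≢a₃ , a₂≢a₄ , a₃≢a₄
    , ℕₚ.≤-trans (s≤s z≤n) a₁a₂-parallel , a₃a₄-edge , inj₁ a₁a₂-parallel
    , λ v w → trans (ℕₚ.+-assoc (mult swapped v w) _ _)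
                (trans (swapped-balance v w) (sym (ℕₚ.+-assoc (mult G v w) _ _)))

  swapped-≤ : ∀ v w → mult swapped v w ℕ.≤ mult G v w + added v w
  swapped-≤ v w = ℕₚ.≤-trans (ℕₚ.m≤m+n _ (removed v w)) (ℕₚ.≤-reflexive (swapped-balance v w))

  swapped-≤-unadded : ∀ {v w} → added v w ≡ 0 → mult swapped v w ℕ.≤ mult G v w
  swapped-≤-unadded {v} {w} ≡0 = +-≤-cancel (swapped-balance v w) (ℕₚ.≤-trans (ℕₚ.≤-reflexive ≡0) z≤n)

  swapped-≥-unremoved : ∀ {v w} → removed v w ≡ 0 → mult G v w ℕ.≤ mult swapped v w
  swapped-≥-unremoved {v} {w} ≡0 = +-≤-cancel (sym (swapped-balance v w)) (ℕₚ.≤-trans (ℕₚ.≤-reflexive ≡0) z≤n)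

  swapped-removes : mult swapped a₁ a₂ ℕ.< mult G a₁ a₂
  swapped-removes = +-<-cancel (swapped-balance a₁ a₂) (begin-strict
    added a₁ a₂    ≡⟨ cong₂ _+_ (ind-≡0ˡ a₂ a₁≢a₂ a₁≢a₃) (ind-≡0ʳ a₁ a₂≢a₄ (a₁≢a₂ ∘ sym)) ⟩
    0              <⟨ s≤s z≤n ⟩
    1              ≡⟨ ind-≡1 a₁ a₂ ⟨
    ind a₁ a₂ a₁ a₂ ≤⟨ ℕₚ.m≤m+n _ _ ⟩
    removed a₁ a₂  ∎)
    where open ℕₚ.≤-Reasoning

  swapped-adds : mult G a₂ a₃ ℕ.< mult swapped a₂ a₃
  swapped-adds = +-<-cancel (sym (swapped-balance a₂ a₃)) (begin-strict
    removed a₂ a₃  ≡⟨ cong₂ _+_ (ind-≡0ʳ a₂ (a₁≢a₃ ∘ sym) (a₂≢a₃ ∘ sym))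
                                (ind-≡0ˡ a₃ a₂≢a₃ a₂≢a₄) ⟩
    0              <⟨ s≤s z≤n ⟩
    1              ≡⟨ ind-≡1 a₂ a₃ ⟨
    ind a₂ a₃ a₂ a₃ ≤⟨ ℕₚ.m≤m+n _ _ ⟩
    added a₂ a₃    ∎)
    where open ℕₚ.≤-Reasoning

module _ {n : ℕ} where

  NoNewParallel : Multigraph n → Multigraph n → Set
  NoNewParallel G G′ = ∀ v w → 2 ℕ.≤ mult G′ v w → mult G′ v w ℕ.≤ mult G v w

  FreshGain : Multigraph n → (Fin n → Fin n → ℕ) → Set
  FreshGain G g = ∀ v w → g v w ≡ 0 ⊎ (g v w ≡ 1 × mult G v w ≡ 0)

  ind-fresh : ∀ {G : Multigraph n} {a b} → mult G a b ≡ 0 → FreshGain G (ind a b)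
  ind-fresh {G} {a} {b} ab≡0 v w with ind-0∨1 a b v w
  ... | inj₁ ≡0 = inj₁ ≡0
  ... | inj₂ ≡1 = inj₂ (≡1 , trans (mult-of-ind G ≡1) ab≡0)

  ind-+-fresh : ∀ {G : Multigraph n} {a b} {h : Fin n → Fin n → ℕ} → mult G a b ≡ 0 → FreshGain G h
              → (∀ v w → ind a b v w ≡ 1 → h v w ≡ 0) → FreshGain G (λ v w → ind a b v w + h v w)
  ind-+-fresh {G} {a} {b} {h} ab≡0 h-fresh apart v w with ind-fresh {G} ab≡0 v w
  ... | inj₁ ≡0 = subst (λ i → i + h v w ≡ 0 ⊎ (i + h v w ≡ 1 × mult G v w ≡ 0)) (sym ≡0) (h-fresh v w)
  ... | inj₂ (≡1 , vw≡0) = inj₂ (cong₂ _+_ ≡1 (apart v w ≡1) , vw≡0)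

  no-new-parallel : ∀ {G G′ : Multigraph n} {g} → FreshGain G g
                  → (∀ v w → mult G′ v w ℕ.≤ mult G v w + g v w) → NoNewParallel G G′
  no-new-parallel {G = G} {G′ = G′} {g = g} fresh G′≤G+g v w parallel with fresh v w
  ... | inj₁ ≡0 = ℕₚ.≤-trans (G′≤G+g v w) (ℕₚ.≤-reflexive (trans (cong (mult G v w +_) ≡0) (ℕₚ.+-identityʳ _)))
  ... | inj₂ (≡1 , vw≡0) = contradiction
          (ℕₚ.≤-trans parallel (ℕₚ.≤-trans (G′≤G+g v w) (ℕₚ.≤-reflexive (cong₂ _+_ vw≡0 ≡1))))
          λ { (s≤s ()) }

  TypeLe⇒TypeLt : ∀ {a₁ a₂ u₁ u₂ : Fin n} → TypeLe a₁ a₂ u₁ u₂ → ¬ (a₁ ≡ u₁ × a₂ ≡ u₂)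
                → TypeLt a₁ a₂ u₁ u₂
  TypeLe⇒TypeLt (inj₁ a₁<u₁)         _ = inj₁ a₁<u₁
  TypeLe⇒TypeLt (inj₂ (refl , a₂≤u₂)) ≢ =
    inj₂ (refl , Finₚ.≤∧≢⇒< a₂≤u₂ (λ a₂≡u₂ → ≢ (refl , a₂≡u₂)))

  nonSimple-inherited : ∀ {G G′ : Multigraph n} {a₁ a₂} → NoNewParallel G G′
                      → NonSimpleType G′ a₁ a₂ → NonSimpleType G a₁ a₂
  nonSimple-inherited {a₁ = a₁} {a₂} thin (a₂<a₁ , parallel) = a₂<a₁ , ℕₚ.≤-trans parallel (thin a₁ a₂ parallel)

  ≺-of-thinning : ∀ {G G′ : Multigraph n} {u₁ u₂} → MaxNonSimple G u₁ u₂ → NoNewParallel G G′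
                → mult G′ u₁ u₂ ℕ.< mult G u₁ u₂ → G′ ≺ G
  ≺-of-thinning {G} {G′} {u₁} {u₂} max@((u₂<u₁ , _) , below-max) thin fewer with 2 ℕ.≤? mult G′ u₁ u₂
  ... | yes parallel = u₁ , u₂ , max ,
          inj₂ (((u₂<u₁ , parallel) , λ a₁ a₂ t → below-max a₁ a₂ (nonSimple-inherited {G} {G′} thin t)) , fewer)
  ... | no ¬parallel = u₁ , u₂ , max , inj₁ λ a₁ a₂ t →
          TypeLe⇒TypeLt (below-max a₁ a₂ (nonSimple-inherited {G} {G′} thin t)) λ { (refl , refl) → ¬parallel (proj₂ t) }

module Minimal {n} (d : Fin n → ℕ) (d-respects-< : ∀ u v → d u ℕ.< d v → u Fin.< v)
  (G : Multigraph n) (deg≡d : ∀ v → deg G v ≡ d v)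
  (unimprovable : ∀ G′ → Reach G G′ → ¬ (G′ ≺ G))
  {u₁ u₂ : Fin n} (max : MaxNonSimple G u₁ u₂) where

  m : Fin n → Fin n → ℕ
  m = mult G

  u₂<u₁ : u₂ Fin.< u₁
  u₂<u₁ = proj₁ (proj₁ max)

  u₁≢u₂ : u₁ ≢ u₂
  u₁≢u₂ u₁≡u₂ = Finₚ.<-irrefl (sym u₁≡u₂) u₂<u₁

  u₁u₂-parallel : 2 ℕ.≤ m u₁ u₂
  u₁u₂-parallel = proj₂ (proj₁ max)

  u₂u₁-parallel : 2 ℕ.≤ m u₂ u₁
  u₂u₁-parallel = subst (2 ℕ.≤_) (symm G u₁ u₂) u₁u₂-parallel

  u₂<large : ∀ {x} → u₁ Fin.< x → u₂ Fin.< x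
  u₂<large = Finₚ.<-trans u₂<u₁

  >⇒≢ : ∀ {a b : Fin n} → a Fin.< b → b ≢ a
  >⇒≢ a<b b≡a = Finₚ.<-irrefl (sym b≡a) a<b

  deg-<⇒< : ∀ {p q} → deg G p ℕ.< deg G q → p Fin.< q
  deg-<⇒< {p} {q} = d-respects-< p q ∘ subst₂ ℕ._<_ (deg≡d p) (deg≡d q)

  not-above-max : ∀ {a₁ a₂} → u₁ Fin.< a₁ → ¬ NonSimpleType G a₁ a₂
  not-above-max {a₁} {a₂} u₁<a₁ nonSimple with proj₂ max a₁ a₂ nonSimple
  ... | inj₁ a₁<u₁       = Finₚ.<-asym a₁<u₁ u₁<a₁
  ... | inj₂ (refl , _) = Finₚ.<-irrefl refl u₁<a₁

  large-simple : ∀ {a b} → u₁ Fin.< a → a ≢ b → m a b ℕ.≤ 1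
  large-simple {a} {b} u₁<a a≢b with 2 ℕ.≤? m a b
  ... | no ¬parallel = ℕₚ.≤-pred (ℕₚ.≰⇒> ¬parallel)
  ... | yes parallel with Finₚ.<-cmp a b
  ...   | tri< a<b _ _ =
    contradiction (a<b , subst (2 ℕ.≤_) (symm G a b) parallel) (not-above-max (Finₚ.<-trans u₁<a a<b))
  ...   | tri≈ _ a≡b _ = contradiction a≡b a≢b
  ...   | tri> _ _ b<a = contradiction (b<a , parallel) (not-above-max u₁<a)

  large-row-≤ : ∀ {x} → u₁ Fin.< x → ∀ u z → z ≢ x → (1 ℕ.≤ m x z → m u z ≢ 0) → m x z ℕ.≤ m u z
  large-row-≤ {x} u₁<x u z z≢x uz≢0 with 1 ℕ.≤? m x z
  ... | no ¬xz = ℕₚ.≤-trans (ℕₚ.≤-pred (ℕₚ.≰⇒> ¬xz)) z≤n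
  ... | yes xz = ℕₚ.≤-trans (large-simple u₁<x (z≢x ∘ sym)) (ℕₚ.n≢0⇒n>0 (uz≢0 xz))

  large-row-undominated : ∀ {x u u′} → u₁ Fin.< x → u Fin.< x → u′ ≢ x → u′ ≢ u
    → m x u′ ℕ.< m u u′
    → ¬ (∀ z → z ≢ x → z ≢ u → z ≢ u′ → 1 ℕ.≤ m x z → m u z ≢ 0)
  large-row-undominated {x} {u} {u′} u₁<x u<x u′≢x u′≢u strict adjacent-to-u =
    Finₚ.<-asym u<x (deg-<⇒< (deg-< G x u u′ u′≢x u′≢u strict
      λ z z≢x z≢u z≢u′ → large-row-≤ u₁<x u z z≢x (adjacent-to-u z z≢x z≢u z≢u′)))

  no-thinning : ∀ G′ (g : Fin n → Fin n → ℕ) → Reach G G′ → FreshGain G g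
    → (∀ v w → mult G′ v w ℕ.≤ m v w + g v w) → ¬ (mult G′ u₁ u₂ ℕ.< m u₁ u₂)
  no-thinning G′ g reach fresh bound fewer =
    unimprovable G′ reach
      (≺-of-thinning {G = G} {G′ = G′} max (no-new-parallel {G = G} {G′ = G′} {g = g} fresh bound) fewer)

  no-single-swap : ∀ {a b} → a ≢ u₁ → a ≢ u₂ → b ≢ u₁ → b ≢ u₂ → a ≢ b
    → 1 ℕ.≤ m a b → m u₁ a ≡ 0 → m u₂ b ≡ 0 → ⊥
  no-single-swap {a} {b} a≢u₁ a≢u₂ b≢u₁ b≢u₂ a≢b ab u₁a≡0 u₂b≡0 =
    no-thinning swapped added (swapped-admissible ◅ ε)
      (ind-+-fresh {G = G} u₁a≡0 (ind-fresh {G = G} (trans (symm G b u₂) u₂b≡0))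
        (ind-apartˡ (b≢u₁ ∘ sym) u₁≢u₂))
      swapped-≤
      (subst₂ ℕ._<_ (symm swapped u₂ u₁) (symm G u₂ u₁) swapped-removes)
    where open Swap G (u₁≢u₂ ∘ sym) (a≢u₂ ∘ sym) (b≢u₂ ∘ sym) (a≢u₁ ∘ sym) (b≢u₁ ∘ sym) a≢b u₂u₁-parallel ab

  large-adjacent-u₁ : ∀ {x} → u₁ Fin.< x → 1 ℕ.≤ m u₁ x
  large-adjacent-u₁ {x} u₁<x = ℕₚ.n≢0⇒n>0 λ u₁x≡0 →
    large-row-undominated u₁<x (u₂<large u₁<x) (Finₚ.<⇒≢ u₁<x) u₁≢u₂
      (subst (ℕ._< m u₂ u₁) (sym (trans (symm G x u₁) u₁x≡0)) (ℕₚ.≤-trans (s≤s z≤n) u₂u₁-parallel))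
      λ z z≢x z≢u₂ z≢u₁ xz u₂z≡0 →
        no-single-swap (>⇒≢ u₁<x) (>⇒≢ (u₂<large u₁<x)) z≢u₁ z≢u₂ (z≢x ∘ sym) xz u₁x≡0 u₂z≡0

  large-adjacent-u₂ : ∀ {x} → u₁ Fin.< x → 1 ℕ.≤ m u₂ x
  large-adjacent-u₂ {x} u₁<x = ℕₚ.n≢0⇒n>0 λ u₂x≡0 →
    large-row-undominated u₁<x u₁<x (Finₚ.<⇒≢ (u₂<large u₁<x)) (u₁≢u₂ ∘ sym)
      (subst (ℕ._< m u₁ u₂) (sym (trans (symm G x u₂) u₂x≡0)) (ℕₚ.≤-trans (s≤s z≤n) u₁u₂-parallel))
      λ z z≢x z≢u₁ z≢u₂ xz u₁z≡0 →
        no-single-swap z≢u₁ z≢u₂ (>⇒≢ u₁<x) (>⇒≢ (u₂<large u₁<x)) z≢x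
          (subst (1 ℕ.≤_) (symm G x z) xz) u₁z≡0 u₂x≡0

  -- First (u₁,u₂)(x,z), which makes u₂x non-simple (u₂ is adjacent to x), then
  -- (u₂,x)(y,w); the edge u₂x added by the first swap is removed by the second.
  no-double-swap : ∀ {x y z w} → u₁ Fin.< x → u₁ Fin.< y → x ≢ y → m x y ≡ 0
    → z ≢ x → z ≢ u₁ → z ≢ u₂ → 1 ℕ.≤ m x z → m u₁ z ≡ 0
    → w ≢ y → w ≢ u₁ → w ≢ u₂ → 1 ℕ.≤ m y w → m u₂ w ≡ 0 → ⊥
  no-double-swap {x} {y} {z} {w} u₁<x u₁<y x≢y xy≡0 z≢x z≢u₁ z≢u₂ xz u₁z≡0 w≢y w≢u₁ w≢u₂ yw u₂w≡0 =
    no-thinning S₂.swapped (λ v v′ → ind z u₁ v v′ + (ind x y v v′ + ind w u₂ v v′))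
      (_◅_ {j = S₁.swapped} S₁.swapped-admissible (S₂.swapped-admissible ◅ ε)) fresh bound fewer
    where
    x≢u₁ : x ≢ u₁
    x≢u₁ = >⇒≢ u₁<x
    x≢u₂ : x ≢ u₂
    x≢u₂ = >⇒≢ (u₂<large u₁<x)
    y≢u₁ : y ≢ u₁
    y≢u₁ = >⇒≢ u₁<y
    y≢u₂ : y ≢ u₂
    y≢u₂ = >⇒≢ (u₂<large u₁<y)
    y≢z : y ≢ z
    y≢z y≡z = ℕₚ.n>0⇒n≢0 (subst (λ t → 1 ℕ.≤ m x t) (sym y≡z) xz) xy≡0
    w≢x : w ≢ x
    w≢x w≡x = ℕₚ.n>0⇒n≢0 (subst (λ t → 1 ℕ.≤ m y t) w≡x yw) (trans (symm G y x) xy≡0)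

    module S₁ = Swap G u₁≢u₂ (x≢u₁ ∘ sym) (z≢u₁ ∘ sym) (x≢u₂ ∘ sym) (z≢u₂ ∘ sym) (z≢x ∘ sym)
                  u₁u₂-parallel xz

    u₂x-parallel : 2 ℕ.≤ mult S₁.swapped u₂ x
    u₂x-parallel = ℕₚ.≤-trans (s≤s (large-adjacent-u₂ u₁<x)) S₁.swapped-adds

    yw-edge : 1 ℕ.≤ mult S₁.swapped y w
    yw-edge = ℕₚ.≤-trans yw (S₁.swapped-≥-unremoved (cong₂ _+_ (ind-≡0ˡ w y≢u₁ y≢u₂) (ind-≡0ˡ w y≢x y≢z)))
      where
      y≢x : y ≢ x
      y≢x = x≢y ∘ sym

    module S₂ = Swap S₁.swapped (x≢u₂ ∘ sym) (y≢u₂ ∘ sym) (w≢u₂ ∘ sym) x≢y (w≢x ∘ sym) (w≢y ∘ sym)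
                  u₂x-parallel yw-edge

    fresh : FreshGain G (λ v v′ → ind z u₁ v v′ + (ind x y v v′ + ind w u₂ v v′))
    fresh = ind-+-fresh {G = G} (trans (symm G z u₁) u₁z≡0)
      (ind-+-fresh {G = G} xy≡0 (ind-fresh {G = G} (trans (symm G w u₂) u₂w≡0)) (ind-apartˡ (w≢x ∘ sym) x≢u₂))
      λ v v′ ≡1 → cong₂ _+_ (ind-apartʳ (x≢u₁ ∘ sym) (y≢u₁ ∘ sym) v v′ ≡1)
                            (ind-apartʳ (w≢u₁ ∘ sym) u₁≢u₂ v v′ ≡1)

    bound : ∀ v v′ → mult S₂.swapped v v′ ℕ.≤ m v v′ + (ind z u₁ v v′ + (ind x y v v′ + ind w u₂ v v′))
    bound v v′ = transit-≤ {x = m v v′} {x₁ = mult S₁.swapped v v′} {x₂ = mult S₂.swapped v v′}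
      {r = ind u₂ x v v′} {s = ind y w v v′} {o = ind z u₁ v v′} {p = S₁.removed v v′} {a = S₂.added v v′}
      (S₂.swapped-balance v v′) (S₁.swapped-balance v v′)

    fewer : mult S₂.swapped u₁ u₂ ℕ.< m u₁ u₂
    fewer = ℕₚ.≤-<-trans
      (S₂.swapped-≤-unadded {u₁} {u₂}
        (cong₂ _+_ (ind-≡0ˡ u₂ (x≢u₁ ∘ sym) (y≢u₁ ∘ sym)) (ind-≡0ˡ u₂ (w≢u₁ ∘ sym) u₁≢u₂)))
      S₁.swapped-removes

  large-adjacent : ∀ {x y} → u₁ Fin.< x → u₁ Fin.< y → x ≢ y → 1 ℕ.≤ m x y
  large-adjacent {x} {y} u₁<x u₁<y x≢y = ℕₚ.n≢0⇒n>0 λ xy≡0 →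
    large-row-undominated u₁<x u₁<x u₂≢x (u₁≢u₂ ∘ sym) (strict u₁<x (u₂≢x ∘ sym) u₁u₂-parallel)
      λ z z≢x z≢u₁ z≢u₂ xz u₁z≡0 →
        large-row-undominated u₁<y (u₂<large u₁<y) (Finₚ.<⇒≢ u₁<y) u₁≢u₂
          (strict u₁<y (>⇒≢ u₁<y) u₂u₁-parallel)
          λ w w≢y w≢u₂ w≢u₁ yw u₂w≡0 →
            no-double-swap u₁<x u₁<y x≢y xy≡0 z≢x z≢u₁ z≢u₂ xz u₁z≡0 w≢y w≢u₁ w≢u₂ yw u₂w≡0
    where
    u₂≢x : u₂ ≢ x
    u₂≢x = Finₚ.<⇒≢ (u₂<large u₁<x)
    strict : ∀ {a u u′} → u₁ Fin.< a → a ≢ u′ → 2 ℕ.≤ m u u′ → m a u′ ℕ.< m u u′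
    strict u₁<a a≢u′ parallel = ℕₚ.≤-<-trans (large-simple u₁<a a≢u′) parallel

  adjacent : ∀ {v w} → InLU u₁ u₂ v → InLU u₁ u₂ w → v ≢ w → Adjacent G v w
  adjacent (inj₁ refl)                  (inj₁ refl)                  v≢w = contradiction refl v≢w
  adjacent (inj₁ refl)                  (inj₂ (inj₁ refl))           _   = ℕₚ.≤-trans (s≤s z≤n) u₁u₂-parallel
  adjacent (inj₁ refl)                  (inj₂ (inj₂ (_ , _ , u₁<w))) _   = large-adjacent-u₁ u₁<w
  adjacent (inj₂ (inj₁ refl))           (inj₁ refl)                  _   = ℕₚ.≤-trans (s≤s z≤n) u₂u₁-parallel
  adjacent (inj₂ (inj₁ refl))           (inj₂ (inj₁ refl))           v≢w = contradiction refl v≢w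
  adjacent (inj₂ (inj₁ refl))           (inj₂ (inj₂ (_ , _ , u₁<w))) _   = large-adjacent-u₂ u₁<w
  adjacent (inj₂ (inj₂ (_ , _ , u₁<v))) (inj₁ refl)                  _   =
    subst (1 ℕ.≤_) (symm G u₁ _) (large-adjacent-u₁ u₁<v)
  adjacent (inj₂ (inj₂ (_ , _ , u₁<v))) (inj₂ (inj₁ refl))           _   =
    subst (1 ℕ.≤_) (symm G u₂ _) (large-adjacent-u₂ u₁<v)
  adjacent (inj₂ (inj₂ (_ , _ , u₁<v))) (inj₂ (inj₂ (_ , _ , u₁<w))) v≢w = large-adjacent u₁<v u₁<w v≢w

lemma5p6 : (n : ℕ) (d : Fin n → ℕ)
    → (∀ u v → d u ℕ.< d v → u Fin.< v)
    → (G : Multigraph n)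
    → (∀ v → deg G v ≡ d v)
    → ¬ IsSimple G
    → (∀ G' → Reach G G' → ¬ (G' ≺ G))
    → (u₁ u₂ : Fin n) → MaxNonSimple G u₁ u₂
    → ∀ v w → InLU u₁ u₂ v → InLU u₁ u₂ w → v ≢ w → Adjacent G v w
-- Non-simplicity of G is already witnessed by its maximal non-simple type.
lemma5p6 n d d-respects-< G deg≡d _ unimprovable u₁ u₂ max v w =
  Minimal.adjacent d d-respects-< G deg≡d unimprovable max
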